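{- Let $a,b,c$ be integers with $0\le a,b<c$, and let $d$ be the integer with $0\le d<c$ and $d\equiv 1-a-b\pmod c$. Let $P_{a,b,c}$ be the parallelepiped spanned by $(1,0,0)$, $(0,1,0)$ and $(a,b,c)$, i.e. $\{s(1,0,0)+t(0,1,0)+u(a,b,c): 0\le s,t,u\le 1\}$. If the tetrahedron $T_{a,b,c}$ is empty, then $P_{a,b,c}$ contains exactly $c-1$ lattice points in its interior. Moreover: if $a=1$, all of these lattice points lie on the plane $x=1$; if $b=1$, all of them lie on the plane $y=1$; if $d=1$, all of them lie on the plane $x+y-z=1$.
   Context: $T_{a,b,c}$ denotes the tetrahedron with vertices $(0,0,0)$, $(1,0,0)$, $(0,1,0)$, $(a,b,c)$. A lattice polyhedron is empty if it contains no points of $\mathbb{Z}^3$ other than its vertices. Lattice points are points of $\mathbb{Z}^3$. -}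

module Defs where

open import Data.Integer as ℤ using (ℤ; +_)
open import Data.Rational as ℚ using (ℚ; 0ℚ; 1ℚ)
open import Data.Product using (Σ; ∃; _×_; _,_)

toℚ : ℤ → ℚ
toℚ n = n ℚ./ 1

Point : Set
Point = ℤ × ℤ × ℤ

-- p lies in T_{a,b,c} = conv{0, e1, e2, (a,b,c)}:
-- p = λ0·0 + s·e1 + t·e2 + u·(a,b,c) with λ0,s,t,u ≥ 0 and λ0+s+t+u = 1
-- (λ0 = 1 - s - t - u is eliminated, giving s + t + u ≤ 1).
InT : ℤ → ℤ → ℤ → Point → Set
InT a b c (x , y , z) =
  Σ ℚ λ s → Σ ℚ λ t → Σ ℚ λ u →
    (0ℚ ℚ.≤ s) × (0ℚ ℚ.≤ t) × (0ℚ ℚ.≤ u) × (s ℚ.+ t ℚ.+ u ℚ.≤ 1ℚ) ×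
    (toℚ x ≡ s ℚ.+ u ℚ.* toℚ a) × (toℚ y ≡ t ℚ.+ u ℚ.* toℚ b) × (toℚ z ≡ u ℚ.* toℚ c)
  where open import Relation.Binary.PropositionalEquality using (_≡_)

IsVertex : ℤ → ℤ → ℤ → Point → Set
IsVertex a b c p =
  (p ≡ (+ 0 , + 0 , + 0)) ⊎ (p ≡ (+ 1 , + 0 , + 0)) ⊎
  (p ≡ (+ 0 , + 1 , + 0)) ⊎ (p ≡ (a , b , c))
  where open import Relation.Binary.PropositionalEquality using (_≡_)
        open import Data.Sum using (_⊎_)

EmptyT : ℤ → ℤ → ℤ → Set
EmptyT a b c = (p : Point) → InT a b c p → IsVertex a b c p

-- p lies in the interior of P_{a,b,c} = {s e1 + t e2 + u (a,b,c) : 0 ≤ s,t,u ≤ 1}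
-- (for c > 0 the parallelepiped is non-degenerate, and its interior is the
-- set of such combinations with 0 < s,t,u < 1).
InIntP : ℤ → ℤ → ℤ → Point → Set
InIntP a b c (x , y , z) =
  Σ ℚ λ s → Σ ℚ λ t → Σ ℚ λ u →
    (0ℚ ℚ.< s) × (s ℚ.< 1ℚ) × (0ℚ ℚ.< t) × (t ℚ.< 1ℚ) × (0ℚ ℚ.< u) × (u ℚ.< 1ℚ) ×
    (toℚ x ≡ s ℚ.+ u ℚ.* toℚ a) × (toℚ y ≡ t ℚ.+ u ℚ.* toℚ b) × (toℚ z ≡ u ℚ.* toℚ c)
  where open import Relation.Binary.PropositionalEquality using (_≡_)

-- A point p = s e₁ + t e₂ + u (a , b , c) of ℤ³ has integral scaled coordinates
-- S = c x - z a, T = c y - z b and z (= c u), and it lies in the interior of P exactly when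
-- 0 < S, T, z < c. At each height 0 < k < c the window 0 < c x - k a < c leaves a single
-- candidate x = ⌊k a / c⌋ + 1, and similarly for y; the candidate is interior iff c ∤ k a
-- and c ∤ k b. Emptiness of T excludes c ∣ k a: with r = k b mod c, the lattice point
-- (k a / c , ⌊k b / c⌋ + 1 , k) if k ≤ r, or (a , b , c) - (k a / c , ⌊k b / c⌋ , k) if r ≤ k,
-- lies in T at a height strictly between 0 and c. For the planes: if a = 1 then
-- c x = S + z lies strictly between 0 and 2c, so x = 1; the case b = 1 is symmetric; and
-- d = 1 forces a + b ∈ {0 , c}, where a + b = c gives c (x + y - z) = S + T, while a + b = 0
-- leaves no interior points at all.

module Submission where

open import Defs
open import Data.Integer using (ℤ; +_; _+_; _-_; _≤_; _<_)
open import Data.Integer.Divisibility using (_∣_)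
open import Data.List using (List; length)
open import Data.List.Membership.Propositional using (_∈_)
open import Data.List.Relation.Unary.Unique.Propositional using (Unique)
open import Data.Product using (Σ; _×_; _,_)
open import Relation.Binary.PropositionalEquality using (_≡_)

open import Algebra.Properties.Group using (∙-cancelʳ)
open import Data.Empty using (⊥; ⊥-elim)
open import Data.Integer as ℤ using (-[1+_]; _*_; +<+; +≤+)
open import Data.Integer.Divisibility using (divides)
open import Data.Integer.DivMod using (_/ℕ_; _%ℕ_; a≡a%ℕn+[a/ℕn]*n; n%ℕd<d)
import Data.Integer.Properties as ℤP
open import Data.Integer.Tactic.RingSolver using (solve-∀)
open import Data.List using (applyUpTo)
import Data.List.Properties as List
open import Data.List.Membership.Propositional.Properties using (∈-applyUpTo⁺; ∈-applyUpTo⁻)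
import Data.List.Relation.Unary.Unique.Propositional.Properties as Unique
open import Data.Nat as ℕ using (ℕ; suc; z≤n; s≤s)
import Data.Nat.Coprimality as Coprime
import Data.Nat.Properties as ℕP
open import Data.Product using (proj₂)
open import Data.Rational as ℚ using (ℚ; mkℚ; 0ℚ; 1ℚ)
import Data.Rational.Properties as ℚP
open import Data.Rational.Unnormalised as ℚᵘ using (mkℚᵘ; *≡*; *≤*; *<*)
import Data.Rational.Unnormalised.Properties as ℚᵘP
open import Data.Sum using (_⊎_; inj₁; inj₂; [_,_]′)
open import Function using (_∘_)
open import Relation.Binary.PropositionalEquality
  using (_≢_; refl; sym; trans; cong; cong₂; subst; subst₂; module ≡-Reasoning)

toℚᵘ-toℚ : ∀ i → ℚ.toℚᵘ (toℚ i) ≡ mkℚᵘ i 0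
toℚᵘ-toℚ (+ n)    = cong ℚ.toℚᵘ (ℚP.normalize-coprime (Coprime.sym (Coprime.1-coprimeTo n)))
toℚᵘ-toℚ -[1+ n ] = cong (λ q → ℚ.toℚᵘ (ℚ.- q)) (ℚP.normalize-coprime (Coprime.sym (Coprime.1-coprimeTo (suc n))))

toℚ-+ : ∀ i j → toℚ (i + j) ≡ toℚ i ℚ.+ toℚ j
toℚ-+ i j = ℚP.toℚᵘ-injective (begin
  ℚ.toℚᵘ (toℚ (i + j))                   ≡⟨ toℚᵘ-toℚ (i + j) ⟩
  mkℚᵘ (i + j) 0                         ≈⟨ *≡* (cong₂ (λ u v → (u + v) * + 1) (sym (ℤP.*-identityʳ i)) (sym (ℤP.*-identityʳ j))) ⟩
  mkℚᵘ i 0 ℚᵘ.+ mkℚᵘ j 0                 ≡⟨ cong₂ ℚᵘ._+_ (toℚᵘ-toℚ i) (toℚᵘ-toℚ j) ⟨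
  ℚ.toℚᵘ (toℚ i) ℚᵘ.+ ℚ.toℚᵘ (toℚ j)     ≈⟨ ℚP.toℚᵘ-homo-+ (toℚ i) (toℚ j) ⟨
  ℚ.toℚᵘ (toℚ i ℚ.+ toℚ j)               ∎)
  where open ℚᵘP.≃-Reasoning

toℚ-* : ∀ i j → toℚ (i * j) ≡ toℚ i ℚ.* toℚ j
toℚ-* i j = ℚP.toℚᵘ-injective (begin
  ℚ.toℚᵘ (toℚ (i * j))                   ≡⟨ toℚᵘ-toℚ (i * j) ⟩
  mkℚᵘ (i * j) 0                         ≡⟨ cong₂ ℚᵘ._*_ (toℚᵘ-toℚ i) (toℚᵘ-toℚ j) ⟨
  ℚ.toℚᵘ (toℚ i) ℚᵘ.* ℚ.toℚᵘ (toℚ j)     ≈⟨ ℚP.toℚᵘ-homo-* (toℚ i) (toℚ j) ⟨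
  ℚ.toℚᵘ (toℚ i ℚ.* toℚ j)               ∎)
  where open ℚᵘP.≃-Reasoning

toℚ-mono-≤ : ∀ {i j} → i ≤ j → toℚ i ℚ.≤ toℚ j
toℚ-mono-≤ {i} {j} i≤j = ℚP.toℚᵘ-cancel-≤ (subst₂ ℚᵘ._≤_ (sym (toℚᵘ-toℚ i)) (sym (toℚᵘ-toℚ j))
  (*≤* (subst₂ _≤_ (sym (ℤP.*-identityʳ i)) (sym (ℤP.*-identityʳ j)) i≤j)))

toℚ-mono-< : ∀ {i j} → i < j → toℚ i ℚ.< toℚ j
toℚ-mono-< {i} {j} i<j = ℚP.toℚᵘ-cancel-< (subst₂ ℚᵘ._<_ (sym (toℚᵘ-toℚ i)) (sym (toℚᵘ-toℚ j))
  (*<* (subst₂ _<_ (sym (ℤP.*-identityʳ i)) (sym (ℤP.*-identityʳ j)) i<j)))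

toℚ-cancel-< : ∀ {i j} → toℚ i ℚ.< toℚ j → i < j
toℚ-cancel-< {i} {j} i<j with subst₂ ℚᵘ._<_ (toℚᵘ-toℚ i) (toℚᵘ-toℚ j) (ℚP.toℚᵘ-mono-< i<j)
... | *<* i*1<j*1 = subst₂ _<_ (ℤP.*-identityʳ i) (ℤP.*-identityʳ j) i*1<j*1

InT-swap : ∀ {a b c x y z} → InT a b c (x , y , z) → InT b a c (y , x , z)
InT-swap (s , t , u , 0≤s , 0≤t , 0≤u , s+t+u≤1 , x≡ , y≡ , z≡) =
  t , s , u , 0≤t , 0≤s , 0≤u , subst (ℚ._≤ 1ℚ) (cong (ℚ._+ u) (ℚP.+-comm s t)) s+t+u≤1 , y≡ , x≡ , z≡

IsVertex-swap : ∀ {a b c x y z} → IsVertex a b c (x , y , z) → IsVertex b a c (y , x , z)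
IsVertex-swap (inj₁ refl)                  = inj₁ refl
IsVertex-swap (inj₂ (inj₁ refl))           = inj₂ (inj₂ (inj₁ refl))
IsVertex-swap (inj₂ (inj₂ (inj₁ refl)))    = inj₂ (inj₁ refl)
IsVertex-swap (inj₂ (inj₂ (inj₂ refl)))    = inj₂ (inj₂ (inj₂ refl))

EmptyT-swap : ∀ {a b c} → EmptyT a b c → EmptyT b a c
EmptyT-swap {a} {b} {c} empty (y , x , z) yxz∈T =
  IsVertex-swap {a} {b} {c} (empty (x , y , z) (InT-swap {b} {a} {c} {y} {x} {z} yxz∈T))

InIntP-swap : ∀ {a b c x y z} → InIntP a b c (x , y , z) → InIntP b a c (y , x , z)
InIntP-swap (s , t , u , 0<s , s<1 , 0<t , t<1 , 0<u , u<1 , x≡ , y≡ , z≡) =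
  t , s , u , 0<t , t<1 , 0<s , s<1 , 0<u , u<1 , y≡ , x≡ , z≡

0<i<2⇒i≡1 : ∀ {i} → + 0 < i → i < + 2 → i ≡ + 1
0<i<2⇒i≡1 (+<+ (s≤s z≤n)) (+<+ (s≤s (s≤s z≤n))) = refl

0<i<1⇒⊥ : ∀ {i} → + 0 < i → i < + 1 → ⊥
0<i<1⇒⊥ (+<+ (s≤s z≤n)) (+<+ (s≤s ()))

1-[1-i-j]≡i+j : ∀ i j → + 1 - (+ 1 - i - j) ≡ i + j
1-[1-i-j]≡i+j = solve-∀

i<j⇒0<j-i : ∀ {i j} → i < j → + 0 < j - i
i<j⇒0<j-i {i} {j} i<j = subst (_< j - i) (ℤP.+-inverseʳ i) (ℤP.+-monoˡ-< (ℤ.- i) i<j)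

0<j⇒i-j<i : ∀ i {j} → + 0 < j → i - j < i
0<j⇒i-j<i i 0<j = subst (i - _ <_) (ℤP.+-identityʳ i) (ℤP.+-monoʳ-< i (ℤP.neg-mono-< 0<j))

i+j≡0⇒i≡0 : ∀ {i j} → + 0 ≤ i → + 0 ≤ j → i + j ≡ + 0 → i ≡ + 0
i+j≡0⇒i≡0 {+ m} (+≤+ _) (+≤+ _) m+n≡0 = cong +_ (ℕP.m+n≡0⇒m≡0 m (ℤP.+-injective m+n≡0))

module WithHeight (n : ℕ) where

  c : ℤ
  c = + suc n

  -- c as a rational in normal form, so that instance search sees that it is positive
  ĉ : ℚ
  ĉ = mkℚ c 0 (Coprime.sym (Coprime.1-coprimeTo (suc n)))

  toℚ-c : toℚ c ≡ ĉ
  toℚ-c = ℚP.normalize-coprime (Coprime.sym (Coprime.1-coprimeTo (suc n)))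

  instance
    1/ĉ-positive : ℚ.Positive (ℚ.1/ ĉ)
    1/ĉ-positive = ℚP.1/pos⇒pos ĉ

  infix 8 _/c
  _/c : ℤ → ℚ
  v /c = toℚ v ℚ.* ℚ.1/ ĉ

  [c*v]/c≡v : ∀ v → (c * v) /c ≡ toℚ v
  [c*v]/c≡v v = begin
    toℚ (c * v) ℚ.* ℚ.1/ ĉ     ≡⟨ cong (ℚ._* ℚ.1/ ĉ) (trans (toℚ-* c v) (cong (ℚ._* toℚ v) toℚ-c)) ⟩
    ĉ ℚ.* toℚ v ℚ.* ℚ.1/ ĉ     ≡⟨ cong (ℚ._* ℚ.1/ ĉ) (ℚP.*-comm ĉ (toℚ v)) ⟩
    toℚ v ℚ.* ĉ ℚ.* ℚ.1/ ĉ     ≡⟨ ℚP.*-assoc (toℚ v) ĉ (ℚ.1/ ĉ) ⟩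
    toℚ v ℚ.* (ĉ ℚ.* ℚ.1/ ĉ)   ≡⟨ cong (toℚ v ℚ.*_) (ℚP.*-inverseʳ ĉ) ⟩
    toℚ v ℚ.* 1ℚ               ≡⟨ ℚP.*-identityʳ (toℚ v) ⟩
    toℚ v                      ∎
    where open ≡-Reasoning

  /c-+ : ∀ u v → (u + v) /c ≡ u /c ℚ.+ v /c
  /c-+ u v = trans (cong (ℚ._* ℚ.1/ ĉ) (toℚ-+ u v)) (ℚP.*-distribʳ-+ (ℚ.1/ ĉ) (toℚ u) (toℚ v))

  /c-* : ∀ u v → (u * v) /c ≡ u /c ℚ.* toℚ v
  /c-* u v = begin
    toℚ (u * v) ℚ.* ℚ.1/ ĉ       ≡⟨ cong (ℚ._* ℚ.1/ ĉ) (toℚ-* u v) ⟩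
    toℚ u ℚ.* toℚ v ℚ.* ℚ.1/ ĉ   ≡⟨ ℚP.*-assoc (toℚ u) (toℚ v) (ℚ.1/ ĉ) ⟩
    toℚ u ℚ.* (toℚ v ℚ.* ℚ.1/ ĉ) ≡⟨ cong (toℚ u ℚ.*_) (ℚP.*-comm (toℚ v) (ℚ.1/ ĉ)) ⟩
    toℚ u ℚ.* (ℚ.1/ ĉ ℚ.* toℚ v) ≡⟨ ℚP.*-assoc (toℚ u) (ℚ.1/ ĉ) (toℚ v) ⟨
    toℚ u ℚ.* ℚ.1/ ĉ ℚ.* toℚ v   ∎
    where open ≡-Reasoning

  [v/c]*c≡v : ∀ v → v /c ℚ.* toℚ c ≡ toℚ v
  [v/c]*c≡v v = trans (sym (/c-* v c)) (trans (cong _/c (ℤP.*-comm v c)) ([c*v]/c≡v v))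

  c/c≡1 : c /c ≡ 1ℚ
  c/c≡1 = trans (cong (ℚ._* ℚ.1/ ĉ) toℚ-c) (ℚP.*-inverseʳ ĉ)

  /c-unique : ∀ v {q} → toℚ v ≡ q ℚ.* toℚ c → q ≡ v /c
  /c-unique v {q} v≡q*c = sym (begin
    toℚ v ℚ.* ℚ.1/ ĉ           ≡⟨ cong (ℚ._* ℚ.1/ ĉ) v≡q*c ⟩
    q ℚ.* toℚ c ℚ.* ℚ.1/ ĉ     ≡⟨ ℚP.*-assoc q (toℚ c) (ℚ.1/ ĉ) ⟩
    q ℚ.* (c /c)               ≡⟨ cong (q ℚ.*_) c/c≡1 ⟩
    q ℚ.* 1ℚ                   ≡⟨ ℚP.*-identityʳ q ⟩
    q                          ∎)
    where open ≡-Reasoning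

  0/c≡0 : (+ 0) /c ≡ 0ℚ
  0/c≡0 = ℚP.*-zeroˡ (ℚ.1/ ĉ)

  /c-mono-≤ : ∀ {u v} → u ≤ v → u /c ℚ.≤ v /c
  /c-mono-≤ u≤v = ℚP.*-monoʳ-≤-nonNeg (ℚ.1/ ĉ) (toℚ-mono-≤ u≤v)

  /c-mono-< : ∀ {u v} → u < v → u /c ℚ.< v /c
  /c-mono-< u<v = ℚP.*-monoˡ-<-pos (ℚ.1/ ĉ) (toℚ-mono-< u<v)

  /c-cancel-< : ∀ {u v} → u /c ℚ.< v /c → u < v
  /c-cancel-< u/c<v/c = toℚ-cancel-< (ℚP.*-cancelʳ-<-nonNeg (ℚ.1/ ĉ) u/c<v/c)

  Between : ℤ → Set
  Between v = + 0 < v × v < c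

  record InOpenCube (a b x y z : ℤ) : Set where
    constructor open-cube
    field
      S∈ : Between (c * x - z * a)
      T∈ : Between (c * y - z * b)
      z∈ : Between z

  record InSimplex (a b x y z : ℤ) : Set where
    constructor simplex
    field
      0≤S   : + 0 ≤ c * x - z * a
      0≤T   : + 0 ≤ c * y - z * b
      0≤z   : + 0 ≤ z
      sum≤c : (c * x - z * a) + (c * y - z * b) + z ≤ c

  decompose : ∀ a x z → toℚ x ≡ (c * x - z * a) /c ℚ.+ z /c ℚ.* toℚ a
  decompose a x z = begin
    toℚ x                                  ≡⟨ [c*v]/c≡v x ⟨
    (c * x) /c                             ≡⟨ cong _/c (c*x≡[c*x-z*a]+z*a c x z a) ⟩
    (c * x - z * a + z * a) /c             ≡⟨ /c-+ (c * x - z * a) (z * a) ⟩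
    (c * x - z * a) /c ℚ.+ (z * a) /c      ≡⟨ cong ((c * x - z * a) /c ℚ.+_) (/c-* z a) ⟩
    (c * x - z * a) /c ℚ.+ z /c ℚ.* toℚ a  ∎
    where
    open ≡-Reasoning
    c*x≡[c*x-z*a]+z*a : ∀ c x z a → c * x ≡ c * x - z * a + z * a
    c*x≡[c*x-z*a]+z*a = solve-∀

  decompose-unique : ∀ {a x z s} → toℚ x ≡ s ℚ.+ z /c ℚ.* toℚ a → s ≡ (c * x - z * a) /c
  decompose-unique {a} {x} {z} {s} x≡ =
    ∙-cancelʳ ℚP.+-0-group (z /c ℚ.* toℚ a) s _ (trans (sym x≡) (decompose a x z))

  0≤⇒0≤/c : ∀ {v} → + 0 ≤ v → 0ℚ ℚ.≤ v /c
  0≤⇒0≤/c {v} 0≤v = subst (ℚ._≤ v /c) 0/c≡0 (/c-mono-≤ 0≤v)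

  Between⇒0</c : ∀ {v} → Between v → 0ℚ ℚ.< v /c
  Between⇒0</c {v} (0<v , _) = subst (ℚ._< v /c) 0/c≡0 (/c-mono-< 0<v)

  Between⇒/c<1 : ∀ {v} → Between v → v /c ℚ.< 1ℚ
  Between⇒/c<1 {v} (_ , v<c) = subst (v /c ℚ.<_) c/c≡1 (/c-mono-< v<c)

  0<v/c<1⇒Between : ∀ {v} → 0ℚ ℚ.< v /c → v /c ℚ.< 1ℚ → Between v
  0<v/c<1⇒Between {v} 0<v/c v/c<1 =
    /c-cancel-< (subst (ℚ._< v /c) (sym 0/c≡0) 0<v/c) , /c-cancel-< (subst (v /c ℚ.<_) (sym c/c≡1) v/c<1)

  InOpenCube⇒InIntP : ∀ {a b x y z} → InOpenCube a b x y z → InIntP a b c (x , y , z)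
  InOpenCube⇒InIntP {a} {b} {x} {y} {z} (open-cube S∈ T∈ z∈) =
    (c * x - z * a) /c , (c * y - z * b) /c , z /c ,
    Between⇒0</c S∈ , Between⇒/c<1 S∈ , Between⇒0</c T∈ , Between⇒/c<1 T∈ , Between⇒0</c z∈ , Between⇒/c<1 z∈ ,
    decompose a x z , decompose b y z , sym ([v/c]*c≡v z)

  InIntP⇒InOpenCube : ∀ {a b x y z} → InIntP a b c (x , y , z) → InOpenCube a b x y z
  InIntP⇒InOpenCube {a} {b} {x} {y} {z} (s , t , u , 0<s , s<1 , 0<t , t<1 , 0<u , u<1 , x≡ , y≡ , z≡) =
    open-cube (coordinate {a} {x} 0<s s<1 x≡) (coordinate {b} {y} 0<t t<1 y≡)
      (0<v/c<1⇒Between {z} (subst (0ℚ ℚ.<_) u≡z/c 0<u) (subst (ℚ._< 1ℚ) u≡z/c u<1))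
    where
    u≡z/c : u ≡ z /c
    u≡z/c = /c-unique z z≡
    coordinate : ∀ {w v r} → 0ℚ ℚ.< r → r ℚ.< 1ℚ → toℚ v ≡ r ℚ.+ u ℚ.* toℚ w → Between (c * v - z * w)
    coordinate {w} {v} {r} 0<r r<1 v≡ =
      0<v/c<1⇒Between {c * v - z * w} (subst (0ℚ ℚ.<_) r≡ 0<r) (subst (ℚ._< 1ℚ) r≡ r<1)
      where
      r≡ : r ≡ (c * v - z * w) /c
      r≡ = decompose-unique {w} {v} {z} (subst (λ q → toℚ v ≡ r ℚ.+ q ℚ.* toℚ w) u≡z/c v≡)

  InSimplex⇒InT : ∀ {a b x y z} → InSimplex a b x y z → InT a b c (x , y , z)
  InSimplex⇒InT {a} {b} {x} {y} {z} (simplex 0≤S 0≤T 0≤z S+T+z≤c) =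
    S /c , T /c , z /c , 0≤⇒0≤/c 0≤S , 0≤⇒0≤/c 0≤T , 0≤⇒0≤/c 0≤z , sum≤1 ,
    decompose a x z , decompose b y z , sym ([v/c]*c≡v z)
    where
    S = c * x - z * a
    T = c * y - z * b
    sum≤1 : S /c ℚ.+ T /c ℚ.+ z /c ℚ.≤ 1ℚ
    sum≤1 = subst₂ ℚ._≤_ (trans (/c-+ (S + T) z) (cong (ℚ._+ z /c) (/c-+ S T))) c/c≡1 (/c-mono-≤ S+T+z≤c)

  vertex-height : ∀ {a b x y z} → IsVertex a b c (x , y , z) → z ≡ + 0 ⊎ z ≡ c
  vertex-height (inj₁ refl)               = inj₁ refl
  vertex-height (inj₂ (inj₁ refl))        = inj₁ refl
  vertex-height (inj₂ (inj₂ (inj₁ refl))) = inj₁ refl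
  vertex-height (inj₂ (inj₂ (inj₂ refl))) = inj₂ refl

  EmptyT⇒height : ∀ {a b x y z} → EmptyT a b c → InSimplex a b x y z → z ≡ + 0 ⊎ z ≡ c
  EmptyT⇒height {a} {b} {x} {y} {z} empty p∈ =
    vertex-height {a} {b} (empty (x , y , z) (InSimplex⇒InT p∈))

  0<c*i<c+c⇒i≡1 : ∀ {i} → + 0 < c * i → c * i < c + c → i ≡ + 1
  0<c*i<c+c⇒i≡1 {i} 0<ci ci<2c = 0<i<2⇒i≡1
    (ℤP.*-cancelˡ-<-nonNeg c (subst (_< c * i) (sym (ℤP.*-zeroʳ c)) 0<ci))
    (ℤP.*-cancelˡ-<-nonNeg c (subst (c * i <_) (c+c≡c*2 c) ci<2c))
    where
    c+c≡c*2 : ∀ c → c + c ≡ c * + 2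
    c+c≡c*2 = solve-∀

  ¬Between-c* : ∀ i → Between (c * i) → ⊥
  ¬Between-c* i (0<ci , ci<c) = 0<i<1⇒⊥
    (ℤP.*-cancelˡ-<-nonNeg c (subst (_< c * i) (sym (ℤP.*-zeroʳ c)) 0<ci))
    (ℤP.*-cancelˡ-<-nonNeg c (subst (c * i <_) (sym (ℤP.*-identityʳ c)) ci<c))

  c*i≡S+T⇒i≡1 : ∀ {i S T} → c * i ≡ S + T → Between S → Between T → i ≡ + 1
  c*i≡S+T⇒i≡1 ci≡S+T (0<S , S<c) (0<T , T<c) = 0<c*i<c+c⇒i≡1
    (subst (+ 0 <_) (sym ci≡S+T) (ℤP.+-mono-< 0<S 0<T))
    (subst (_< c + c) (sym ci≡S+T) (ℤP.+-mono-< S<c T<c))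

  division : ∀ v → v ≡ + (v %ℕ suc n) + (v /ℕ suc n) * c
  division v = a≡a%ℕn+[a/ℕn]*n v (suc n)

  %<c : ∀ v → + (v %ℕ suc n) < c
  %<c v = +<+ (n%ℕd<d v (suc n))

  Between[c*x-v]⇒x≡1+v/c : ∀ v x → Between (c * x - v) → x ≡ + 1 + v /ℕ suc n
  Between[c*x-v]⇒x≡1+v/c v x (0<S , S<c) = begin
    x              ≡⟨ x≡[x-q]+q x q ⟩
    x - q + q      ≡⟨ cong (_+ q) x-q≡1 ⟩
    + 1 + q        ∎
    where
    open ≡-Reasoning
    q = v /ℕ suc n
    r = + (v %ℕ suc n)
    x≡[x-q]+q : ∀ x q → x ≡ x - q + q
    x≡[x-q]+q = solve-∀
    c[x-q]≡[cx-v]+r : c * (x - q) ≡ (c * x - v) + r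
    c[x-q]≡[cx-v]+r = begin
      c * (x - q)                ≡⟨ identity c x q r ⟩
      (c * x - (r + q * c)) + r  ≡⟨ cong (λ w → (c * x - w) + r) (division v) ⟨
      (c * x - v) + r            ∎
      where
      identity : ∀ c x q r → c * (x - q) ≡ (c * x - (r + q * c)) + r
      identity = solve-∀
    x-q≡1 : x - q ≡ + 1
    x-q≡1 = 0<c*i<c+c⇒i≡1
      (subst (+ 0 <_) (sym c[x-q]≡[cx-v]+r) (ℤP.+-mono-<-≤ 0<S (+≤+ z≤n)))
      (subst (_< c + c) (sym c[x-q]≡[cx-v]+r) (ℤP.+-mono-< S<c (%<c v)))

  c*[1+v/c]-v≡c-v%c : ∀ v → c * (+ 1 + v /ℕ suc n) - v ≡ c - + (v %ℕ suc n)
  c*[1+v/c]-v≡c-v%c v = begin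
    c * (+ 1 + q) - v            ≡⟨ cong (c * (+ 1 + q) -_) (division v) ⟩
    c * (+ 1 + q) - (r + q * c)  ≡⟨ identity c q r ⟩
    c - r                        ∎
    where
    open ≡-Reasoning
    q = v /ℕ suc n
    r = + (v %ℕ suc n)
    identity : ∀ c q r → c * (+ 1 + q) - (r + q * c) ≡ c - r
    identity = solve-∀

  Between⇒height≢ : ∀ {h} → Between h → h ≡ + 0 ⊎ h ≡ c → ⊥
  Between⇒height≢ (0<h , _) (inj₁ refl) = ℤP.<-irrefl refl 0<h
  Between⇒height≢ (_ , h<c) (inj₂ refl) = ℤP.<-irrefl refl h<c

  Between-c- : ∀ {h} → Between h → Between (c - h)
  Between-c- (0<h , h<c) = i<j⇒0<j-i h<c , 0<j⇒i-j<i c 0<h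

  simplex-≡ : ∀ {a b x y z S T} → c * x - z * a ≡ S → c * y - z * b ≡ T →
              + 0 ≤ S → + 0 ≤ T → + 0 ≤ z → S + T + z ≤ c → InSimplex a b x y z
  simplex-≡ refl refl = simplex

  multiple-lower-point : ∀ {a b k q} → k * a ≡ q * c → + 0 ≤ k → k ≤ + ((k * b) %ℕ suc n) →
                         InSimplex a b q (+ 1 + (k * b) /ℕ suc n) k
  multiple-lower-point {a} {b} {k} {q} ka≡qc 0≤k k≤r =
    simplex-≡ S≡0 (c*[1+v/c]-v≡c-v%c (k * b)) ℤP.≤-refl (ℤP.i≤j⇒0≤j-i (ℤP.<⇒≤ (%<c (k * b)))) 0≤k sum≤c
    where
    r = + ((k * b) %ℕ suc n)
    c*q-q*c≡0 : ∀ c q → c * q - q * c ≡ + 0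
    c*q-q*c≡0 = solve-∀
    0+[c-r]+r≡c : ∀ c r → + 0 + (c - r) + r ≡ c
    0+[c-r]+r≡c = solve-∀
    S≡0 : c * q - k * a ≡ + 0
    S≡0 = trans (cong (c * q -_) ka≡qc) (c*q-q*c≡0 c q)
    sum≤c : + 0 + (c - r) + k ≤ c
    sum≤c = subst (+ 0 + (c - r) + k ≤_) (0+[c-r]+r≡c c r) (ℤP.+-monoʳ-≤ (+ 0 + (c - r)) k≤r)

  multiple-upper-point : ∀ {a b k q} → k * a ≡ q * c → k ≤ c → + ((k * b) %ℕ suc n) ≤ k →
                         InSimplex a b (a - q) (b - (k * b) /ℕ suc n) (c - k)
  multiple-upper-point {a} {b} {k} {q} ka≡qc k≤c r≤k =
    simplex-≡ S≡0 T≡r ℤP.≤-refl (+≤+ z≤n) (ℤP.i≤j⇒0≤j-i k≤c) sum≤c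
    where
    open ≡-Reasoning
    r = + ((k * b) %ℕ suc n)
    q′ = (k * b) /ℕ suc n
    reflect : ∀ c a q k → c * (a - q) - (c - k) * a ≡ k * a - q * c
    reflect = solve-∀
    i-i≡0 : ∀ i → i - i ≡ + 0
    i-i≡0 = solve-∀
    r+i-i≡r : ∀ r i → r + i - i ≡ r
    r+i-i≡r = solve-∀
    0+k+[c-k]≡c : ∀ c k → + 0 + k + (c - k) ≡ c
    0+k+[c-k]≡c = solve-∀
    S≡0 : c * (a - q) - (c - k) * a ≡ + 0
    S≡0 = begin
      c * (a - q) - (c - k) * a  ≡⟨ reflect c a q k ⟩
      k * a - q * c              ≡⟨ cong (_- q * c) ka≡qc ⟩
      q * c - q * c              ≡⟨ i-i≡0 (q * c) ⟩
      + 0                        ∎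
    T≡r : c * (b - q′) - (c - k) * b ≡ r
    T≡r = begin
      c * (b - q′) - (c - k) * b ≡⟨ reflect c b q′ k ⟩
      k * b - q′ * c             ≡⟨ cong (_- q′ * c) (division (k * b)) ⟩
      r + q′ * c - q′ * c        ≡⟨ r+i-i≡r r (q′ * c) ⟩
      r                          ∎
    sum≤c : + 0 + r + (c - k) ≤ c
    sum≤c = subst (+ 0 + r + (c - k) ≤_) (0+k+[c-k]≡c c k) (ℤP.+-monoˡ-≤ (c - k) (ℤP.+-monoʳ-≤ (+ 0) r≤k))

  EmptyT⇒¬c∣k*a : ∀ {a b k q} → EmptyT a b c → Between k → k * a ≡ q * c → ⊥
  EmptyT⇒¬c∣k*a {a} {b} {k} {q} empty k∈@(0<k , k<c) ka≡qc with ℤP.≤-total k (+ ((k * b) %ℕ suc n))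
  ... | inj₁ k≤r = Between⇒height≢ k∈
    (EmptyT⇒height empty (multiple-lower-point {a} {b} {k} {q} ka≡qc (ℤP.<⇒≤ 0<k) k≤r))
  ... | inj₂ r≤k = Between⇒height≢ (Between-c- k∈)
    (EmptyT⇒height empty (multiple-upper-point {a} {b} {k} {q} ka≡qc (ℤP.<⇒≤ k<c) r≤k))

  point : ℤ → ℤ → ℤ → Point
  point a b k = + 1 + (k * a) /ℕ suc n , + 1 + (k * b) /ℕ suc n , k

  EmptyT⇒Between[c*[1+ka/c]-ka] : ∀ {a b k} → EmptyT a b c → Between k →
                              Between (c * (+ 1 + (k * a) /ℕ suc n) - k * a)
  EmptyT⇒Between[c*[1+ka/c]-ka] {a} {b} {k} empty k∈ =
    subst Between (sym (c*[1+v/c]-v≡c-v%c (k * a))) (i<j⇒0<j-i (%<c (k * a)) , 0<j⇒i-j<i c 0<r)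
    where
    q = (k * a) /ℕ suc n
    r≢0 : (k * a) %ℕ suc n ≢ 0
    r≢0 r≡0 = EmptyT⇒¬c∣k*a {a} {b} {k} {q} empty k∈
      (trans (division (k * a)) (trans (cong (λ r → + r + q * c) r≡0) (ℤP.+-identityˡ (q * c))))
    0<r : + 0 < + ((k * a) %ℕ suc n)
    0<r = +<+ (ℕP.n≢0⇒n>0 r≢0)

  point-interior : ∀ {a b k} → EmptyT a b c → Between k → InIntP a b c (point a b k)
  point-interior {a} {b} {k} empty k∈ =
    InOpenCube⇒InIntP {a} {b} {+ 1 + (k * a) /ℕ suc n} {+ 1 + (k * b) /ℕ suc n} {k} (open-cube
      (EmptyT⇒Between[c*[1+ka/c]-ka] {a} {b} empty k∈)
      (EmptyT⇒Between[c*[1+ka/c]-ka] {b} {a} (EmptyT-swap {a} {b} empty) k∈)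
      k∈)

  InIntP⇒≡point : ∀ {a b x y z} → InIntP a b c (x , y , z) → (x , y , z) ≡ point a b z
  InIntP⇒≡point {a} {b} {x} {y} {z} p∈ =
    cong₂ _,_ (Between[c*x-v]⇒x≡1+v/c (z * a) x S∈) (cong (_, z) (Between[c*x-v]⇒x≡1+v/c (z * b) y T∈))
    where open InOpenCube (InIntP⇒InOpenCube {a} {b} {x} {y} {z} p∈)

  Between⇒≡+suc : ∀ {k} → Between k → Σ ℕ λ i → i ℕ.< n × k ≡ + suc i
  Between⇒≡+suc {+ 0}      (+<+ () , _)
  Between⇒≡+suc {+ suc i}  (_ , +<+ (s≤s i<n)) = i , i<n , refl
  Between⇒≡+suc { -[1+ _ ]} (() , _)

  interior-points : ℤ → ℤ → List Point
  interior-points a b = applyUpTo (λ i → point a b (+ suc i)) n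

  interior-points-unique : ∀ a b → Unique (interior-points a b)
  interior-points-unique a b = Unique.applyUpTo⁺₁ _ n
    (λ i<j _ pᵢ≡pⱼ → ℕP.<⇒≢ i<j (ℕP.suc-injective (ℤP.+-injective (cong (proj₂ ∘ proj₂) pᵢ≡pⱼ))))

  length-interior-points : ∀ a b → + length (interior-points a b) ≡ c - + 1
  length-interior-points a b = cong +_ (List.length-applyUpTo _ n)

  ∈-interior-points⇒InIntP : ∀ {a b} → EmptyT a b c → ∀ p → p ∈ interior-points a b → InIntP a b c p
  ∈-interior-points⇒InIntP {a} {b} empty p p∈ with ∈-applyUpTo⁻ (λ i → point a b (+ suc i)) p∈
  ... | i , i<n , refl = point-interior {a} {b} empty (+<+ (s≤s z≤n) , +<+ (s≤s i<n))

  InIntP⇒∈-interior-points : ∀ {a b} p → InIntP a b c p → p ∈ interior-points a b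
  InIntP⇒∈-interior-points {a} {b} (x , y , z) p∈ =
    subst (_∈ interior-points a b) (sym (InIntP⇒≡point {a} {b} {x} {y} {z} p∈))
      (point∈ (Between⇒≡+suc (InOpenCube.z∈ (InIntP⇒InOpenCube {a} {b} {x} {y} {z} p∈))))
    where
    point∈ : (Σ ℕ λ i → i ℕ.< n × z ≡ + suc i) → point a b z ∈ interior-points a b
    point∈ (i , i<n , z≡1+i) =
      subst (λ k → point a b k ∈ interior-points a b) (sym z≡1+i) (∈-applyUpTo⁺ (λ i → point a b (+ suc i)) i<n)

  x≡1-if-a≡1 : ∀ b x y z → InIntP (+ 1) b c (x , y , z) → x ≡ + 1
  x≡1-if-a≡1 b x y z p∈ = c*i≡S+T⇒i≡1 (split c x z) S∈ z∈
    where
    open InOpenCube (InIntP⇒InOpenCube {+ 1} {b} {x} {y} {z} p∈)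
    split : ∀ c x z → c * x ≡ (c * x - z * + 1) + z
    split = solve-∀

  ¬InIntP-if-a≡0 : ∀ {b x y z} → InIntP (+ 0) b c (x , y , z) → ⊥
  ¬InIntP-if-a≡0 {b} {x} {y} {z} p∈ = ¬Between-c* x (subst Between (c*x-z*0≡c*x c x z) S∈)
    where
    open InOpenCube (InIntP⇒InOpenCube {+ 0} {b} {x} {y} {z} p∈)
    c*x-z*0≡c*x : ∀ c x z → c * x - z * + 0 ≡ c * x
    c*x-z*0≡c*x = solve-∀

  x+y-z≡1-if-a+b≡c : ∀ {a b x y z} → a + b ≡ c → InIntP a b c (x , y , z) → x + y - z ≡ + 1
  x+y-z≡1-if-a+b≡c {a} {b} {x} {y} {z} a+b≡c p∈ = c*i≡S+T⇒i≡1 c[x+y-z]≡S+T S∈ T∈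
    where
    open InOpenCube (InIntP⇒InOpenCube {a} {b} {x} {y} {z} p∈)
    open ≡-Reasoning
    S = c * x - z * a
    T = c * y - z * b
    expand : ∀ c x y z a b → c * (x + y - z) ≡ (c * x - z * a) + (c * y - z * b) + z * (a + b) - c * z
    expand = solve-∀
    cancel : ∀ S T z c → S + T + z * c - c * z ≡ S + T
    cancel = solve-∀
    c[x+y-z]≡S+T : c * (x + y - z) ≡ S + T
    c[x+y-z]≡S+T = begin
      c * (x + y - z)                ≡⟨ expand c x y z a b ⟩
      S + T + z * (a + b) - c * z    ≡⟨ cong (λ w → S + T + z * w - c * z) a+b≡c ⟩
      S + T + z * c - c * z          ≡⟨ cancel S T z c ⟩
      S + T                          ∎

  c∣m⇒m≡0∨m≡c : ∀ {m} → c ∣ m → + 0 ≤ m → m < c + c → m ≡ + 0 ⊎ m ≡ c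
  c∣m⇒m≡0∨m≡c (divides 0 m≡0)              (+≤+ _) _ = inj₁ (cong +_ m≡0)
  c∣m⇒m≡0∨m≡c (divides 1 m≡c)              (+≤+ _) _ = inj₂ (cong +_ (trans m≡c (ℕP.+-identityʳ (suc n))))
  c∣m⇒m≡0∨m≡c (divides (suc (suc q)) m≡qc) (+≤+ _) (+<+ m<2c) =
    ⊥-elim (ℕP.<⇒≱ m<2c (subst (suc n ℕ.+ suc n ℕ.≤_) (sym m≡qc) (ℕP.+-monoʳ-≤ (suc n) (ℕP.m≤m+n (suc n) _))))

  x+y-z≡1-if-c∣a+b : ∀ {a b} → + 0 ≤ a → + 0 ≤ b → a < c → b < c → c ∣ a + b →
                     ∀ x y z → InIntP a b c (x , y , z) → x + y - z ≡ + 1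
  x+y-z≡1-if-c∣a+b {a} {b} 0≤a 0≤b a<c b<c c∣a+b x y z p∈ =
    [ (λ a+b≡0 → ⊥-elim (¬InIntP-if-a≡0 {b} {x} {y} {z}
        (subst (λ a → InIntP a b c (x , y , z)) (i+j≡0⇒i≡0 0≤a 0≤b a+b≡0) p∈)))
    , (λ a+b≡c → x+y-z≡1-if-a+b≡c {a} {b} {x} {y} {z} a+b≡c p∈)
    ]′ (c∣m⇒m≡0∨m≡c c∣a+b (ℤP.+-mono-≤ 0≤a 0≤b) (ℤP.+-mono-< a<c b<c))

corollary10 : (a b c d : ℤ) →
    + 0 ≤ a → a < c → + 0 ≤ b → b < c →
    + 0 ≤ d → d < c → c ∣ (d - (+ 1 - a - b)) →
    EmptyT a b c →
    (Σ (List Point) λ L → Unique L × (+ length L ≡ c - + 1) ×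
        ((p : Point) → (p ∈ L → InIntP a b c p) × (InIntP a b c p → p ∈ L)))
    × (a ≡ + 1 → (x y z : ℤ) → InIntP a b c (x , y , z) → x ≡ + 1)
    × (b ≡ + 1 → (x y z : ℤ) → InIntP a b c (x , y , z) → y ≡ + 1)
    × (d ≡ + 1 → (x y z : ℤ) → InIntP a b c (x , y , z) → x + y - z ≡ + 1)
corollary10 a b (+ 0)     d (+≤+ _) (+<+ ()) _ _ _ _ _ _
corollary10 a b -[1+ _ ] d (+≤+ _) ()       _ _ _ _ _ _
corollary10 a b (+ suc n) d 0≤a a<c 0≤b b<c _ _ c∣d-[1-a-b] empty =
  ( interior-points a b , interior-points-unique a b , length-interior-points a b
  , λ p → ∈-interior-points⇒InIntP {a} {b} empty p , InIntP⇒∈-interior-points {a} {b} p )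
  , (λ { refl → x≡1-if-a≡1 b })
  , (λ { refl x y z p∈ → x≡1-if-a≡1 a y x z (InIntP-swap {a} {b} {c} {x} {y} {z} p∈) })
  , (λ { refl → x+y-z≡1-if-c∣a+b 0≤a 0≤b a<c b<c (subst (c ∣_) (1-[1-i-j]≡i+j a b) c∣d-[1-a-b]) })
  where open WithHeight n
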